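{- For any finite simple graph $G$ with minimum degree $\delta$ and any positive integer $k$, \[ \mathrm{MOF}_k(G)\geq \max \Big \{ \Big \lfloor \frac{\delta}{2} \Big \rfloor - k + 1, 1 \Big \}. \]
   Context: An orientation $D$ of a simple graph $G$ assigns to each edge exactly one direction; if $(u,v)$ is an arc, $v$ is an out-neighbor of $u$. Oriented $k$-forcing: starting from a nonempty set $S$ of colored vertices, repeatedly, any colored vertex having at most $k$ non-colored out-neighbors forces all of them to become colored (all forcings in a step simultaneous), until no change occurs; $S$ is a $k$-forcing set if all vertices end up colored. $F_k(D)$ is the minimum size of a $k$-forcing set of $D$, and $\mathrm{MOF}_k(G)$ is the maximum of $F_k(D)$ over all orientations $D$ of $G$. -}

module Defs where

open import Data.Nat using (ℕ; zero; suc; _+_; _≤_; _≤ᵇ_; _∸_; _/_; _⊔_)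
open import Data.Bool using (Bool; true; false; _∧_; _∨_; not; T)
open import Data.Fin using (Fin)
open import Data.Vec.Functional using (Vector)
open import Data.Product using (Σ; ∃; _×_; _,_)
open import Relation.Binary.PropositionalEquality using (_≡_)
open import Data.Empty using (⊥)

count : ∀ {n} → (Fin n → Bool) → ℕ
count {zero}  p = 0
count {suc n} p = (if-b (p Fin.zero)) + count (λ i → p (Fin.suc i))
  where
  if-b : Bool → ℕ
  if-b true  = 1
  if-b false = 0

anyF : ∀ {n} → (Fin n → Bool) → Bool
anyF {zero}  p = false
anyF {suc n} p = p Fin.zero ∨ anyF (λ i → p (Fin.suc i))

record Graph (n : ℕ) : Set where
  field
    adj   : Fin n → Fin n → Bool
    sym   : ∀ u v → adj u v ≡ adj v u
    irrefl : ∀ v → adj v v ≡ false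

open Graph public

degree : ∀ {n} → Graph n → Fin n → ℕ
degree G v = count (adj G v)

IsMinDegree : ∀ {n} → Graph n → ℕ → Set
IsMinDegree G δ = (∃ λ v → degree G v ≡ δ) × (∀ v → δ ≤ degree G v)

record Orientation {n : ℕ} (G : Graph n) : Set where
  field
    arc       : Fin n → Fin n → Bool
    arc⇒adj   : ∀ u v → T (arc u v) → T (adj G u v)
    adj⇒arc   : ∀ u v → T (adj G u v) → T (arc u v ∨ arc v u)
    antisym   : ∀ u v → T (arc u v) → T (arc v u) → ⊥

open Orientation public

-- colourings: c v ≡ true means v is coloured
Colouring : ℕ → Set
Colouring n = Fin n → Bool

uncolOut : ∀ {n} {G : Graph n} → Orientation G → Colouring n → Fin n → ℕ
uncolOut D c u = count (λ w → arc D u w ∧ not (c w))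

step : ∀ {n} {G : Graph n} → ℕ → Orientation G → Colouring n → Colouring n
step k D c v = c v ∨ anyF (λ u → c u ∧ (arc D u v ∧ (uncolOut D c u ≤ᵇ k)))

iterate : ∀ {n} {G : Graph n} → ℕ → Orientation G → ℕ → Colouring n → Colouring n
iterate k D zero    c = c
iterate k D (suc t) c = iterate k D t (step k D c)

IsForcingSet : ∀ {n} {G : Graph n} → ℕ → Orientation G → Colouring n → Set
IsForcingSet k D S = T (anyF S) × ∃ λ t → ∀ v → T (iterate k D t S v)

-- b ≤ F_k(D): every k-forcing set of D has at least b vertices
FkAtLeast : ∀ {n} {G : Graph n} → ℕ → Orientation G → ℕ → Set
FkAtLeast k D b = ∀ S → IsForcingSet k D S → b ≤ count S

-- b ≤ MOF_k(G): some orientation D has F_k(D) ≥ b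
MOFAtLeast : ∀ {n} → Graph n → ℕ → ℕ → Set
MOFAtLeast G k b = Σ (Orientation G) λ D → FkAtLeast k D b

-- Orient G so that every out-degree is at least t = ⌊δ/2⌋.  Such an orientation exists: if
-- out(v) < t then out(v) < in(v), so walking backwards along in-arcs from v (deleting each edge
-- used, so the walk stops) reaches a vertex w with out(w) > in(w), hence out(w) > t; reversing the
-- walk moves one unit of out-degree from w to v and strictly decreases Σ max(0, t − out).  In such
-- an orientation a k-forcing set S must contain a vertex u with at most k uncoloured out-neighbours
-- (otherwise nothing is ever forced, so S is everything and any of its vertices could force), and
-- then S contains u together with at least t − k of its out-neighbours.

module Submission where

open import Defs
open import Data.Nat
  using (ℕ; zero; suc; _+_; _∸_; _/_; _⊔_; _≤_; _<_; _≤?_; _<?_; _≤ᵇ_; _<ᵇ_; z≤n; s≤s; s≤s⁻¹)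
open import Data.Nat.DivMod using (m/n*n≤m)
open import Data.Nat.Properties hiding (_≟_; suc-injective)
open import Data.Bool using (Bool; true; false; _∧_; _∨_; not; T; T?)
open import Data.Bool.Properties using (∨-identityʳ; ∧-comm; ∨-comm; ∧-identityʳ; T-∧; T-∨; T-not-≡)
open import Data.Fin using (Fin; toℕ) renaming (zero to fzero; suc to fsuc)
open import Data.Fin.Properties using (_≟_; suc-injective; any?; toℕ-injective)
open import Relation.Binary using (tri<; tri≈; tri>)
open import Data.Product using (Σ; ∃; _×_; _,_; proj₁; proj₂)
open import Data.Empty using (⊥; ⊥-elim)
open import Data.Sum using (inj₁; inj₂)
open import Function.Bundles using (Equivalence)
open Equivalence using (to; from)
open import Data.Unit using (tt)
open import Function using (_∘_)
open import Relation.Nullary using (¬_; yes; no; does; _×-dec_)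
open import Relation.Nullary.Decidable using (dec-true; dec-false; toSum)
open import Relation.Binary.PropositionalEquality hiding (sym)
import Relation.Binary.PropositionalEquality as ≡
open import Algebra.Properties.Monoid.Sum +-0-monoid using (sum)
open import Algebra.Properties.CommutativeSemigroup +-commutativeSemigroup using (interchange; xy∙z≈xz∙y; xy∙z≈zy∙x)

T⇒¬T-∧-not : ∀ {b c} → T c → ¬ T (b ∧ not c)
T⇒¬T-∧-not {true} {true} _ ()

¬T⇒≡false : ∀ {b} → ¬ T b → b ≡ false
¬T⇒≡false {false} _  = refl
¬T⇒≡false {true}  ¬t = ⊥-elim (¬t tt)

𝟙 : Bool → ℕ
𝟙 true  = 1
𝟙 false = 0

count-suc : ∀ {n} (p : Fin (suc n) → Bool) → count p ≡ 𝟙 (p fzero) + count (p ∘ fsuc)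
count-suc p with p fzero
... | true  = refl
... | false = refl

count-cong : ∀ {n} {p q : Fin n → Bool} → p ≗ q → count p ≡ count q
count-cong {zero}  eq = refl
count-cong {suc n} {p} {q} eq rewrite count-suc p | count-suc q | eq fzero =
  cong (𝟙 (q fzero) +_) (count-cong (eq ∘ fsuc))

𝟙-mono : ∀ {a b} → (T a → T b) → 𝟙 a ≤ 𝟙 b
𝟙-mono {false}         _   = z≤n
𝟙-mono {true} {true}   _   = ≤-refl
𝟙-mono {true} {false}  a⇒b = ⊥-elim (a⇒b tt)

count-mono : ∀ {n} {p q : Fin n → Bool} → (∀ i → T (p i) → T (q i)) → count p ≤ count q
count-mono {zero}  p⊆q = z≤n
count-mono {suc n} {p} {q} p⊆q rewrite count-suc p | count-suc q =
  +-mono-≤ (𝟙-mono (p⊆q fzero)) (count-mono (p⊆q ∘ fsuc))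

count-split : ∀ {n} {p q r : Fin n → Bool} → (∀ i → 𝟙 (p i) ≡ 𝟙 (q i) + 𝟙 (r i)) →
  count p ≡ count q + count r
count-split {zero}  split = refl
count-split {suc n} {p} {q} {r} split
  rewrite count-suc p | count-suc q | count-suc r | split fzero | count-split {p = p ∘ fsuc} (split ∘ fsuc) =
  interchange (𝟙 (q fzero)) (𝟙 (r fzero)) (count (q ∘ fsuc)) (count (r ∘ fsuc))

count-differAt : ∀ {n} {p q : Fin n → Bool} (j : Fin n) → (∀ i → i ≢ j → p i ≡ q i) →
  count p + 𝟙 (q j) ≡ count q + 𝟙 (p j)
count-differAt {suc n} {p} {q} fzero agree
  rewrite count-suc p | count-suc q | count-cong {p = p ∘ fsuc} (λ i → agree (fsuc i) λ ()) =
  xy∙z≈zy∙x (𝟙 (p fzero)) (count (q ∘ fsuc)) (𝟙 (q fzero))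
count-differAt {suc n} {p} {q} (fsuc j) agree
  rewrite count-suc p | count-suc q | agree fzero (λ ())
        | +-assoc (𝟙 (q fzero)) (count (p ∘ fsuc)) (𝟙 (q (fsuc j)))
        | +-assoc (𝟙 (q fzero)) (count (q ∘ fsuc)) (𝟙 (p (fsuc j))) =
  cong (𝟙 (q fzero) +_) (count-differAt j λ i i≢j → agree (fsuc i) (i≢j ∘ suc-injective))

count-removeAt : ∀ {n} {p q : Fin n → Bool} (j : Fin n) → (∀ i → i ≢ j → q i ≡ p i) →
  T (p j) → ¬ T (q j) → count q + 1 ≡ count p
count-removeAt {p = p} {q} j agree pj ¬qj with p j | q j | count-differAt j agree
... | true | false | eq = trans eq (+-identityʳ _)
... | true | true  | _  = ⊥-elim (¬qj tt)

count-strict : ∀ {n} {p q : Fin n → Bool} (j : Fin n) → (∀ i → T (q i) → T (p i)) →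
  T (p j) → ¬ T (q j) → suc (count q) ≤ count p
count-strict {suc n} {p} {q} fzero q⊆p pj ¬qj with p fzero | q fzero
... | true | true  = ⊥-elim (¬qj tt)
... | true | false = s≤s (count-mono (q⊆p ∘ fsuc))
... | false | _    = ⊥-elim pj
count-strict {suc n} {p} {q} (fsuc j) q⊆p pj ¬qj rewrite count-suc p | count-suc q =
  subst (_≤ 𝟙 (p fzero) + count (p ∘ fsuc)) (+-suc (𝟙 (q fzero)) _)
    (+-mono-≤ (𝟙-mono (q⊆p fzero)) (count-strict j (q⊆p ∘ fsuc) pj ¬qj))

count-none : ∀ {n} {p : Fin n → Bool} → (∀ i → ¬ T (p i)) → count p ≡ 0
count-none {zero}  none = refl
count-none {suc n} {p} none rewrite count-suc p | ¬T⇒≡false (none fzero) = count-none (none ∘ fsuc)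

anyF⇒∃ : ∀ {n} {p : Fin n → Bool} → T (anyF p) → ∃ λ i → T (p i)
anyF⇒∃ {suc n} {p} h with p fzero in eq
... | true  = fzero , subst T (≡.sym eq) tt
... | false with anyF⇒∃ h
...   | i , pi = fsuc i , pi

sum-mono : ∀ {n} {f g : Fin n → ℕ} → (∀ i → f i ≤ g i) → sum f ≤ sum g
sum-mono {zero}  f≤g = z≤n
sum-mono {suc n} f≤g = +-mono-≤ (f≤g fzero) (sum-mono (f≤g ∘ fsuc))

sum-strict : ∀ {n} {f g : Fin n → ℕ} (j : Fin n) → (∀ i → f i ≤ g i) → f j < g j → sum f < sum g
sum-strict fzero    f≤g fj<gj = +-mono-<-≤ fj<gj (sum-mono (f≤g ∘ fsuc))
sum-strict (fsuc j) f≤g fj<gj = +-mono-≤-< (f≤g fzero) (sum-strict j (f≤g ∘ fsuc) fj<gj)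

m<n+n⇒m+o<[n+o]+[n+o] : ∀ m n o → m < n + n → m + o < (n + o) + (n + o)
m<n+n⇒m+o<[n+o]+[n+o] m n o m<2n = begin-strict
  m + o             <⟨ +-monoˡ-< o m<2n ⟩
  n + n + o         ≤⟨ +-monoʳ-≤ (n + n) (m≤n+m o o) ⟩
  n + n + (o + o)   ≡⟨ interchange n n o o ⟩
  (n + o) + (n + o) ∎
  where open ≤-Reasoning

[m+1]+[m+1]≤n+1⇒m+m<n : ∀ m n → (m + 1) + (m + 1) ≤ n + 1 → m + m < n
[m+1]+[m+1]≤n+1⇒m+m<n m n le rewrite +-comm m 1 | +-comm n 1 = subst (_≤ n) (+-suc m m) (s≤s⁻¹ le)

m+m<n+n⇒m<n : ∀ {m n} → m + m < n + n → m < n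
m+m<n+n⇒m<n {m} {n} 2m<2n with m <? n
... | yes m<n = m<n
... | no m≮n = ⊥-elim (<⇒≱ 2m<2n (+-mono-≤ (≮⇒≥ m≮n) (≮⇒≥ m≮n)))

n/2+n/2≤n : ∀ n → n / 2 + n / 2 ≤ n
n/2+n/2≤n n = ≤-trans (≤-reflexive (trans (cong (n / 2 +_) (≡.sym (+-identityʳ (n / 2)))) (*-comm 2 (n / 2))))
                      (m/n*n≤m n 2)

-- Deleting an edge and reinserting it reversed
_≐_ : ∀ {n} → Fin n → Fin n → Bool
x ≐ y = does (x ≟ y)

≐-refl : ∀ {n} (x : Fin n) → x ≐ x ≡ true
≐-refl x = dec-true (x ≟ x) refl

≐-≢ : ∀ {n} {x y : Fin n} → x ≢ y → x ≐ y ≡ false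
≐-≢ {x = x} {y} = dec-false (x ≟ y)

isArc : ∀ {n} → Fin n → Fin n → Fin n → Fin n → Bool
isArc i j x y = x ≐ i ∧ y ≐ j

joins : ∀ {n} → Fin n → Fin n → Fin n → Fin n → Bool
joins i j x y = isArc i j x y ∨ isArc i j y x

isArc-true : ∀ {n} (i j x y : Fin n) → T (isArc i j x y) → x ≡ i × y ≡ j
isArc-true i j x y h with x ≟ i | y ≟ j
... | yes x≡i | yes y≡j = x≡i , y≡j

isArc-false : ∀ {n} (i j x y : Fin n) → ¬ (x ≡ i × y ≡ j) → isArc i j x y ≡ false
isArc-false i j x y ne with x ≟ i | y ≟ j
... | yes x≡i | yes y≡j = ⊥-elim (ne (x≡i , y≡j))
... | yes _   | no _    = refl
... | no _    | _       = refl

joins-false : ∀ {n} (i j x y : Fin n) → ¬ (x ≡ i × y ≡ j) → ¬ (y ≡ i × x ≡ j) → joins i j x y ≡ false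
joins-false i j x y ne₁ ne₂ = cong₂ _∨_ (isArc-false i j x y ne₁) (isArc-false i j y x ne₂)

isArc-ij : ∀ {n} (i j : Fin n) → T (isArc i j i j)
isArc-ij i j rewrite ≐-refl i | ≐-refl j = tt

joins-ij : ∀ {n} (i j : Fin n) → T (joins i j i j)
joins-ij i j = from T-∨ (inj₁ (isArc-ij i j))

joins-ji : ∀ {n} (i j : Fin n) → T (joins i j j i)
joins-ji i j = from T-∨ (inj₂ (isArc-ij i j))

joins-flip : ∀ {n} (i j x y : Fin n) → joins j i x y ≡ joins i j x y
joins-flip i j x y = trans (cong₂ _∨_ (∧-comm (x ≐ j) (y ≐ i)) (∧-comm (y ≐ j) (x ≐ i)))
                           (∨-comm (isArc i j y x) (isArc i j x y))

adj⇒≢ : ∀ {n} (G : Graph n) {i j : Fin n} → T (adj G i j) → i ≢ j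
adj⇒≢ G {i} ij refl = subst T (irrefl G i) ij

deleteEdge : ∀ {n} → Graph n → Fin n → Fin n → Graph n
deleteEdge G i j = record
  { adj    = λ x y → adj G x y ∧ not (joins i j x y)
  ; sym    = λ x y → cong₂ _∧_ (Graph.sym G x y) (cong not (∨-comm (isArc i j x y) (isArc i j y x)))
  ; irrefl = λ x → cong (_∧ not (joins i j x x)) (irrefl G x)
  }

deleteEdge-¬ij : ∀ {n} (G : Graph n) (i j : Fin n) → ¬ T (adj (deleteEdge G i j) i j)
deleteEdge-¬ij G i j = T⇒¬T-∧-not (joins-ij i j)

deleteEdge-¬ji : ∀ {n} (G : Graph n) (i j : Fin n) → ¬ T (adj (deleteEdge G i j) j i)
deleteEdge-¬ji G i j = T⇒¬T-∧-not (joins-ji i j)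

deleteEdge-agrees : ∀ {n} (G : Graph n) (i j x y : Fin n) → ¬ (x ≡ i × y ≡ j) → ¬ (y ≡ i × x ≡ j) →
  adj (deleteEdge G i j) x y ≡ adj G x y
deleteEdge-agrees G i j x y ne₁ ne₂ rewrite joins-false i j x y ne₁ ne₂ = ∧-identityʳ (adj G x y)

degree-deleteEdge : ∀ {n} (G : Graph n) {i j : Fin n} → T (adj G i j) →
  ∀ x → degree (deleteEdge G i j) x + (𝟙 (x ≐ i) + 𝟙 (x ≐ j)) ≡ degree G x
degree-deleteEdge G {i} {j} ij x with toSum (x ≟ i) | toSum (x ≟ j)
... | inj₁ refl | inj₁ refl = ⊥-elim (adj⇒≢ G ij refl)
... | inj₁ refl | inj₂ x≢j =
  trans (cong (λ b → degree (deleteEdge G x j) x + (𝟙 b + 𝟙 (x ≐ j))) (≐-refl x))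
  (trans (cong (λ b → degree (deleteEdge G x j) x + (1 + 𝟙 b)) (≐-≢ x≢j))
  (count-removeAt j (λ y y≢j → deleteEdge-agrees G x j x y (y≢j ∘ proj₂) (x≢j ∘ proj₂))
    ij (deleteEdge-¬ij G x j)))
... | inj₂ x≢i | inj₁ refl =
  trans (cong (λ b → degree (deleteEdge G i x) x + (𝟙 b + 𝟙 (x ≐ x))) (≐-≢ x≢i))
  (trans (cong (λ b → degree (deleteEdge G i x) x + 𝟙 b) (≐-refl x))
  (count-removeAt i (λ y y≢i → deleteEdge-agrees G i x x y (x≢i ∘ proj₁) (y≢i ∘ proj₁))
    (subst T (Graph.sym G i x) ij) (deleteEdge-¬ji G i x)))
... | inj₂ x≢i | inj₂ x≢j =
  trans (cong₂ (λ a b → degree (deleteEdge G i j) x + (𝟙 a + 𝟙 b)) (≐-≢ x≢i) (≐-≢ x≢j))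
  (trans (+-identityʳ _) (count-cong λ y → deleteEdge-agrees G i j x y (x≢i ∘ proj₁) (x≢j ∘ proj₂)))

outdegree : ∀ {n} {G : Graph n} → Orientation G → Fin n → ℕ
outdegree D x = count (arc D x)

restrict : ∀ {n} {G : Graph n} → Orientation G → (i j : Fin n) → Orientation (deleteEdge G i j)
restrict {G = G} D i j = record
  { arc     = λ x y → arc D x y ∧ not (joins i j x y)
  ; arc⇒adj = λ x y h → let (a , nj) = to T-∧ h in from (T-∧ {adj G x y}) (arc⇒adj D x y a , nj)
  ; adj⇒arc = adj⇒arc′
  ; antisym = λ x y h₁ h₂ → antisym D x y (proj₁ (to (T-∧ {arc D x y}) h₁))
                                          (proj₁ (to (T-∧ {arc D y x}) h₂))
  }
  where
  adj⇒arc′ : ∀ x y → T (adj G x y ∧ not (joins i j x y)) →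
    T (arc D x y ∧ not (joins i j x y) ∨ arc D y x ∧ not (joins i j y x))
  adj⇒arc′ x y h with to (T-∧ {adj G x y}) h
  ... | e , nj with to (T-∨ {arc D x y}) (adj⇒arc D x y e)
  ...   | inj₁ a = from (T-∨ {arc D x y ∧ not (joins i j x y)}) (inj₁ (from (T-∧ {arc D x y}) (a , nj)))
  ...   | inj₂ a = from (T-∨ {arc D x y ∧ not (joins i j x y)})
                     (inj₂ (from (T-∧ {arc D y x})
                       (a , subst (T ∘ not) (∨-comm (isArc i j x y) (isArc i j y x)) nj)))

outdegree-restrict : ∀ {n} {G : Graph n} (D : Orientation G) {i j : Fin n} → T (arc D i j) →
  ∀ x → outdegree (restrict D i j) x + 𝟙 (x ≐ i) ≡ outdegree D x
outdegree-restrict {G = G} D {i} {j} ij x with toSum (x ≟ i)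
... | inj₁ refl =
  trans (cong (λ b → outdegree (restrict D x j) x + 𝟙 b) (≐-refl x))
  (count-removeAt j agree ij (T⇒¬T-∧-not (joins-ij x j)))
  where
  agree : ∀ y → y ≢ j → arc D x y ∧ not (joins x j x y) ≡ arc D x y
  agree y y≢j rewrite joins-false x j x y (y≢j ∘ proj₂) (adj⇒≢ G (arc⇒adj D x j ij) ∘ proj₂) =
    ∧-identityʳ (arc D x y)
... | inj₂ x≢i =
  trans (cong (λ b → outdegree (restrict D i j) x + 𝟙 b) (≐-≢ x≢i))
  (trans (+-identityʳ _) (count-cong agree))
  where
  agree : ∀ y → arc D x y ∧ not (joins i j x y) ≡ arc D x y
  agree y with toSum (y ≟ i) | toSum (x ≟ j)
  ... | inj₁ refl | inj₁ refl rewrite ¬T⇒≡false (antisym D y x ij) = refl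
  ... | inj₁ _    | inj₂ x≢j rewrite joins-false i j x y (x≢i ∘ proj₁) (x≢j ∘ proj₂) =
    ∧-identityʳ (arc D x y)
  ... | inj₂ y≢i  | _        rewrite joins-false i j x y (x≢i ∘ proj₁) (y≢i ∘ proj₁) =
    ∧-identityʳ (arc D x y)

insertArc : ∀ {n} {G : Graph n} {i j : Fin n} → Orientation (deleteEdge G j i) → T (adj G i j) → Orientation G
insertArc {G = G} {i} {j} D₁ ij = record
  { arc     = λ x y → arc D₁ x y ∨ isArc i j x y
  ; arc⇒adj = arc⇒adj′
  ; adj⇒arc = adj⇒arc′
  ; antisym = antisym′
  }
  where
  ¬arc-ji : ¬ T (arc D₁ j i)
  ¬arc-ji = deleteEdge-¬ij G j i ∘ arc⇒adj D₁ j i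

  arc⇒adj′ : ∀ x y → T (arc D₁ x y ∨ isArc i j x y) → T (adj G x y)
  arc⇒adj′ x y h with to (T-∨ {arc D₁ x y}) h
  ... | inj₁ a = proj₁ (to (T-∧ {adj G x y}) (arc⇒adj D₁ x y a))
  ... | inj₂ e with isArc-true i j x y e
  ...   | refl , refl = ij

  adj⇒arc′ : ∀ x y → T (adj G x y) → T ((arc D₁ x y ∨ isArc i j x y) ∨ (arc D₁ y x ∨ isArc i j y x))
  adj⇒arc′ x y h with toSum (T? (isArc i j x y)) | toSum (T? (isArc i j y x))
  ... | inj₁ e | _ = from (T-∨ {arc D₁ x y ∨ isArc i j x y}) (inj₁ (from (T-∨ {arc D₁ x y}) (inj₂ e)))
  ... | inj₂ _ | inj₁ e =
    from (T-∨ {arc D₁ x y ∨ isArc i j x y}) (inj₂ (from (T-∨ {arc D₁ y x}) (inj₂ e)))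
  ... | inj₂ ¬e₁ | inj₂ ¬e₂
    with to (T-∨ {arc D₁ x y}) (adj⇒arc D₁ x y (from (T-∧ {adj G x y}) (h , unjoined)))
    where
    unjoined : T (not (joins j i x y))
    unjoined rewrite joins-flip i j x y | ¬T⇒≡false ¬e₁ | ¬T⇒≡false ¬e₂ = tt
  ...   | inj₁ a = from (T-∨ {arc D₁ x y ∨ isArc i j x y}) (inj₁ (from (T-∨ {arc D₁ x y}) (inj₁ a)))
  ...   | inj₂ a = from (T-∨ {arc D₁ x y ∨ isArc i j x y}) (inj₂ (from (T-∨ {arc D₁ y x}) (inj₁ a)))

  antisym′ : ∀ x y → T (arc D₁ x y ∨ isArc i j x y) → T (arc D₁ y x ∨ isArc i j y x) → ⊥
  antisym′ x y h₁ h₂ with to (T-∨ {arc D₁ x y}) h₁ | to (T-∨ {arc D₁ y x}) h₂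
  ... | inj₁ a | inj₁ b = antisym D₁ x y a b
  ... | inj₁ a | inj₂ e with isArc-true i j y x e
  ...   | refl , refl = ¬arc-ji a
  antisym′ x y h₁ h₂ | inj₂ e | inj₁ b with isArc-true i j x y e
  ...   | refl , refl = ¬arc-ji b
  antisym′ x y h₁ h₂ | inj₂ e | inj₂ e′ with isArc-true i j x y e | isArc-true i j y x e′
  ...   | refl , refl | refl , _ = adj⇒≢ G ij refl

outdegree-insertArc : ∀ {n} {G : Graph n} {i j : Fin n} (D₁ : Orientation (deleteEdge G j i)) (ij : T (adj G i j)) →
  ∀ x → outdegree (insertArc D₁ ij) x ≡ outdegree D₁ x + 𝟙 (x ≐ i)
outdegree-insertArc {G = G} {i} {j} D₁ ij x with toSum (x ≟ i)
... | inj₁ refl =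
  trans (≡.sym (count-removeAt j agree (from (T-∨ {arc D₁ x j}) (inj₂ (isArc-ij x j))) ¬arc-xj))
        (cong (λ b → outdegree D₁ x + 𝟙 b) (≡.sym (≐-refl x)))
  where
  ¬arc-xj : ¬ T (arc D₁ x j)
  ¬arc-xj = deleteEdge-¬ji G j x ∘ arc⇒adj D₁ x j
  agree : ∀ y → y ≢ j → arc D₁ x y ≡ arc D₁ x y ∨ isArc x j x y
  agree y y≢j rewrite isArc-false x j x y (y≢j ∘ proj₂) = ≡.sym (∨-identityʳ (arc D₁ x y))
... | inj₂ x≢i =
  trans (count-cong agree)
  (trans (≡.sym (+-identityʳ _)) (cong (λ b → outdegree D₁ x + 𝟙 b) (≡.sym (≐-≢ x≢i))))
  where
  agree : ∀ y → arc D₁ x y ∨ isArc i j x y ≡ arc D₁ x y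
  agree y rewrite isArc-false i j x y (x≢i ∘ proj₁) = ∨-identityʳ (arc D₁ x y)

-- Orientations with large minimum out-degree
orientByIndex : ∀ {n} (G : Graph n) → Orientation G
orientByIndex {n} G = record
  { arc     = λ u v → adj G u v ∧ (toℕ u <ᵇ toℕ v)
  ; arc⇒adj = λ u v → proj₁ ∘ to (T-∧ {adj G u v})
  ; adj⇒arc = adj⇒arc′
  ; antisym = λ u v h₁ h₂ → <-asym (<ᵇ⇒< (toℕ u) (toℕ v) (proj₂ (to (T-∧ {adj G u v}) h₁)))
                                   (<ᵇ⇒< (toℕ v) (toℕ u) (proj₂ (to (T-∧ {adj G v u}) h₂)))
  }
  where
  adj⇒arc′ : ∀ u v → T (adj G u v) →
    T (adj G u v ∧ (toℕ u <ᵇ toℕ v) ∨ adj G v u ∧ (toℕ v <ᵇ toℕ u))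
  adj⇒arc′ u v e with <-cmp (toℕ u) (toℕ v)
  ... | tri< u<v _ _ = from (T-∨ {adj G u v ∧ (toℕ u <ᵇ toℕ v)})
                         (inj₁ (from (T-∧ {adj G u v}) (e , <⇒<ᵇ u<v)))
  ... | tri≈ _ u≡v _ = ⊥-elim (adj⇒≢ G e (toℕ-injective u≡v))
  ... | tri> _ _ v<u = from (T-∨ {adj G u v ∧ (toℕ u <ᵇ toℕ v)})
                         (inj₂ (from (T-∧ {adj G v u}) (subst T (Graph.sym G u v) e , <⇒<ᵇ v<u)))

outdegree<degree⇒inArc : ∀ {n} {G : Graph n} (D : Orientation G) (v : Fin n) →
  outdegree D v < degree G v → ∃ λ u → T (arc D u v)
outdegree<degree⇒inArc {G = G} D v out<deg with any? (λ u → T? (adj G v u ∧ not (arc D v u)))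
... | yes (u , h) with to (T-∧ {adj G v u}) h
...   | e , ¬vu with to (T-∨ {arc D v u}) (adj⇒arc D v u e)
...     | inj₁ vu = ⊥-elim (T⇒¬T-∧-not {true} vu ¬vu)
...     | inj₂ uv = u , uv
outdegree<degree⇒inArc {G = G} D v out<deg | no ∄u = ⊥-elim (<⇒≱ out<deg (count-mono adj⇒out))
  where
  adj⇒out : ∀ u → T (adj G v u) → T (arc D v u)
  adj⇒out u e with T? (arc D v u)
  ... | yes vu = vu
  ... | no ¬vu = ⊥-elim (∄u (u , from (T-∧ {adj G v u}) (e , from T-not-≡ (¬T⇒≡false ¬vu))))

record PathReversal {n} {G : Graph n} (D : Orientation G) (v : Fin n) : Set where
  field
    reversed : Orientation G
    source   : Fin n
    surplus  : degree G source < outdegree D source + outdegree D source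
    shift    : ∀ x → outdegree reversed x + 𝟙 (x ≐ source) ≡ outdegree D x + 𝟙 (x ≐ v)

module _ {n} {G : Graph n} (D : Orientation G) {u v : Fin n} (uv : T (arc D u v)) where

  private
    G₁ : Graph n
    G₁ = deleteEdge G u v
    D₁ : Orientation G₁
    D₁ = restrict D u v
    u≢v : u ≢ v
    u≢v = adj⇒≢ G (arc⇒adj D u v uv)
    vu : T (adj G v u)
    vu = subst T (Graph.sym G u v) (arc⇒adj D u v uv)

  deficit-restrict : ¬ (degree G u < outdegree D u + outdegree D u) →
    outdegree D₁ u + outdegree D₁ u < degree G₁ u
  deficit-restrict ¬surplus = [m+1]+[m+1]≤n+1⇒m+m<n (outdegree D₁ u) (degree G₁ u) (begin
    (outdegree D₁ u + 1) + (outdegree D₁ u + 1) ≡⟨ cong (λ o → o + o) out₁ ⟩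
    outdegree D u + outdegree D u               ≤⟨ ≮⇒≥ ¬surplus ⟩
    degree G u                                  ≡⟨ ≡.sym deg₁ ⟩
    degree G₁ u + 1                             ∎)
    where
    open ≤-Reasoning
    out₁ : outdegree D₁ u + 1 ≡ outdegree D u
    out₁ = trans (cong (λ b → outdegree D₁ u + 𝟙 b) (≡.sym (≐-refl u))) (outdegree-restrict D uv u)
    deg₁ : degree G₁ u + 1 ≡ degree G u
    deg₁ = trans (cong₂ (λ a b → degree G₁ u + (𝟙 a + 𝟙 b)) (≡.sym (≐-refl u)) (≡.sym (≐-≢ u≢v)))
                 (degree-deleteEdge G (arc⇒adj D u v uv) u)

  surplus-restrict : outdegree D v + outdegree D v < degree G v → ∀ w →
    degree G₁ w < outdegree D₁ w + outdegree D₁ w → degree G w < outdegree D w + outdegree D w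
  surplus-restrict deficient w surplus₁ with toSum (w ≟ v)
  ... | inj₁ refl = ⊥-elim (<⇒≱ deficient (begin
    degree G v                      ≡⟨ ≡.sym deg₁ ⟩
    degree G₁ v + 1                 ≡⟨ +-comm (degree G₁ v) 1 ⟩
    suc (degree G₁ v)               ≤⟨ surplus₁ ⟩
    outdegree D₁ v + outdegree D₁ v ≡⟨ cong (λ o → o + o) out₁ ⟩
    outdegree D v + outdegree D v   ∎))
    where
    open ≤-Reasoning
    v≢u : v ≢ u
    v≢u = u≢v ∘ ≡.sym
    deg₁ : degree G₁ v + 1 ≡ degree G v
    deg₁ = trans (cong₂ (λ a b → degree G₁ v + (𝟙 a + 𝟙 b)) (≡.sym (≐-≢ v≢u)) (≡.sym (≐-refl v)))
                 (degree-deleteEdge G (arc⇒adj D u v uv) v)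
    out₁ : outdegree D₁ v ≡ outdegree D v
    out₁ = trans (≡.sym (+-identityʳ _))
           (trans (cong (λ b → outdegree D₁ v + 𝟙 b) (≡.sym (≐-≢ v≢u))) (outdegree-restrict D uv v))
  ... | inj₂ w≢v = subst₂ _<_ deg₁ (cong (λ o → o + o) (outdegree-restrict D uv w))
                     (m<n+n⇒m+o<[n+o]+[n+o] (degree G₁ w) (outdegree D₁ w) (𝟙 (w ≐ u)) surplus₁)
    where
    deg₁ : degree G₁ w + 𝟙 (w ≐ u) ≡ degree G w
    deg₁ = trans (cong (λ b → degree G₁ w + b) (≡.sym (+-identityʳ (𝟙 (w ≐ u)))))
           (trans (cong (λ b → degree G₁ w + (𝟙 (w ≐ u) + 𝟙 b)) (≡.sym (≐-≢ w≢v)))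
                  (degree-deleteEdge G (arc⇒adj D u v uv) w))

  insertReversed : Orientation G₁ → Orientation G
  insertReversed D₁′ = insertArc D₁′ vu

  shift-insertReversed : (D₁′ : Orientation G₁) (w : Fin n) →
    (∀ x → outdegree D₁′ x + 𝟙 (x ≐ w) ≡ outdegree D₁ x + 𝟙 (x ≐ u)) →
    ∀ x → outdegree (insertReversed D₁′) x + 𝟙 (x ≐ w) ≡ outdegree D x + 𝟙 (x ≐ v)
  shift-insertReversed D₁′ w shift₁ x = begin
    outdegree (insertReversed D₁′) x + 𝟙 (x ≐ w) ≡⟨ cong (_+ 𝟙 (x ≐ w)) (outdegree-insertArc D₁′ vu x) ⟩
    outdegree D₁′ x + 𝟙 (x ≐ v) + 𝟙 (x ≐ w)      ≡⟨ xy∙z≈xz∙y (outdegree D₁′ x) (𝟙 (x ≐ v)) (𝟙 (x ≐ w))⟩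
    outdegree D₁′ x + 𝟙 (x ≐ w) + 𝟙 (x ≐ v)      ≡⟨ cong (_+ 𝟙 (x ≐ v)) (shift₁ x) ⟩
    outdegree D₁ x + 𝟙 (x ≐ u) + 𝟙 (x ≐ v)       ≡⟨ cong (_+ 𝟙 (x ≐ v)) (outdegree-restrict D uv x) ⟩
    outdegree D x + 𝟙 (x ≐ v)                    ∎
    where open ≡-Reasoning

  sum-outdegree-restrict : sum (outdegree D₁) < sum (outdegree D)
  sum-outdegree-restrict = sum-strict u
    (λ x → ≤-trans (m≤m+n _ _) (≤-reflexive (outdegree-restrict D uv x)))
    (≤-reflexive (trans (+-comm 1 (outdegree D₁ u))
                        (trans (cong (λ b → outdegree D₁ u + 𝟙 b) (≡.sym (≐-refl u)))
                               (outdegree-restrict D uv u))))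

-- The surplus/deficit conditions compare out-degree with in-degree = degree − out-degree.  Take an
-- in-arc u → v; if u has a surplus, reverse just that arc, otherwise delete the edge, recurse from
-- u, and reinsert the edge as v → u.  N bounds the number of arcs, which each deletion decreases.
reversePath : ∀ N {n} {G : Graph n} (D : Orientation G) (v : Fin n) → sum (outdegree D) ≤ N →
  outdegree D v + outdegree D v < degree G v → PathReversal D v
reversePath N {G = G} D v bound deficient
  with outdegree<degree⇒inArc D v (≤-<-trans (m≤m+n _ _) deficient)
... | u , uv with degree G u <? outdegree D u + outdegree D u | N
...   | yes surplus | _ = record
  { reversed = insertReversed D uv (restrict D u v)
  ; source   = u
  ; surplus  = surplus
  ; shift    = shift-insertReversed D uv (restrict D u v) u (λ _ → refl)
  }
...   | no ¬surplus | zero = ⊥-elim (n≮0 (≤-trans (sum-outdegree-restrict D uv) bound))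
...   | no ¬surplus | suc N′ = record
  { reversed = insertReversed D uv reversed
  ; source   = source
  ; surplus  = surplus-restrict D uv deficient source surplus
  ; shift    = shift-insertReversed D uv reversed source shift
  }
  where
  open PathReversal (reversePath N′ (restrict D u v) u (s≤s⁻¹ (≤-trans (sum-outdegree-restrict D uv) bound))
                                 (deficit-restrict D uv ¬surplus))

module _ {n} {G : Graph n} (t : ℕ) (2t≤deg : ∀ v → t + t ≤ degree G v) where

  deficiency : Orientation G → ℕ
  deficiency D = sum (λ x → t ∸ outdegree D x)

  deficiency-decreases : (D : Orientation G) (v : Fin n) → outdegree D v < t →
    Σ (Orientation G) λ D′ → deficiency D′ < deficiency D
  deficiency-decreases D v out<t = reversed , sum-strict v pointwise strict
    where
    deficient : outdegree D v + outdegree D v < degree G v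
    deficient = <-≤-trans (+-mono-< out<t out<t) (2t≤deg v)
    open PathReversal (reversePath (sum (outdegree D)) D v ≤-refl deficient)
    t<out-source : t < outdegree D source
    t<out-source = m+m<n+n⇒m<n (≤-<-trans (2t≤deg source) surplus)
    source≢v : source ≢ v
    source≢v eq = <-asym out<t (subst (λ x → t < outdegree D x) eq t<out-source)
    shift-source : outdegree reversed source + 1 ≡ outdegree D source
    shift-source = trans (cong (λ b → outdegree reversed source + 𝟙 b) (≡.sym (≐-refl source)))
                   (trans (shift source)
                   (trans (cong (λ b → outdegree D source + 𝟙 b) (≐-≢ source≢v)) (+-identityʳ _)))
    shift-other : ∀ x → x ≢ source → outdegree reversed x ≡ outdegree D x + 𝟙 (x ≐ v)
    shift-other x x≢source = trans (≡.sym (+-identityʳ _))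
                             (trans (cong (λ b → outdegree reversed x + 𝟙 b) (≡.sym (≐-≢ x≢source)))
                                    (shift x))
    pointwise : ∀ x → t ∸ outdegree reversed x ≤ t ∸ outdegree D x
    pointwise x with toSum (x ≟ source)
    ... | inj₁ refl = ≤-trans (≤-reflexive (m≤n⇒m∸n≡0 t≤out′)) z≤n
      where
      t≤out′ : t ≤ outdegree reversed x
      t≤out′ = s≤s⁻¹ (≤-trans t<out-source (≤-reflexive (trans (≡.sym shift-source) (+-comm _ 1))))
    ... | inj₂ x≢source =
      ∸-monoʳ-≤ t (≤-trans (m≤m+n (outdegree D x) _) (≤-reflexive (≡.sym (shift-other x x≢source))))
    strict : t ∸ outdegree reversed v < t ∸ outdegree D v
    strict = ∸-monoʳ-< out<out′ (≤-trans (≤-reflexive out′≡) out<t)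
      where
      out′≡ : outdegree reversed v ≡ suc (outdegree D v)
      out′≡ = trans (shift-other v (source≢v ∘ ≡.sym))
                    (trans (cong (λ b → outdegree D v + 𝟙 b) (≐-refl v)) (+-comm _ 1))
      out<out′ : outdegree D v < outdegree reversed v
      out<out′ = ≤-reflexive (≡.sym out′≡)

  private
    descend : ∀ N (D : Orientation G) → deficiency D ≤ N →
      Σ (Orientation G) λ D′ → ∀ v → t ≤ outdegree D′ v
    descend N D bound with any? (λ v → outdegree D v <? t)
    ... | no ∄v = D , λ v → ≮⇒≥ (∄v ∘ (v ,_))
    ... | yes (v , out<t) with deficiency-decreases D v out<t | N
    ...   | D′ , smaller | zero   = ⊥-elim (n≮0 (≤-trans smaller bound))
    ...   | D′ , smaller | suc N′ = descend N′ D′ (s≤s⁻¹ (≤-trans smaller bound))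

  balancedOrientation : Σ (Orientation G) λ D → ∀ v → t ≤ outdegree D v
  balancedOrientation = descend _ (orientByIndex G) ≤-refl

-- Oriented k-forcing
module _ {n} {G : Graph n} (k : ℕ) (D : Orientation G) where

  CanForce : Colouring n → Fin n → Set
  CanForce c u = T (c u) × uncolOut D c u ≤ k

  private
    stalled-step : (S : Colouring n) → (∀ u → ¬ CanForce S u) → ∀ c → c ≗ S → step k D c ≗ S
    stalled-step S stuck c c≗S v =
      trans (cong (c v ∨_) (¬T⇒≡false noForcer)) (trans (∨-identityʳ (c v)) (c≗S v))
      where
      noForcer : ¬ T (anyF (λ u → c u ∧ (arc D u v ∧ (uncolOut D c u ≤ᵇ k))))
      noForcer h with anyF⇒∃ h
      ... | u , forces with to (T-∧ {c u}) forces
      ...   | cu , r =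
        stuck u (subst T (c≗S u) cu , subst (_≤ k) uncol≡ (≤ᵇ⇒≤ _ k (proj₂ (to (T-∧ {arc D u v}) r))))
        where
        uncol≡ : uncolOut D c u ≡ uncolOut D S u
        uncol≡ = count-cong λ w → cong (λ b → arc D u w ∧ not b) (c≗S w)

    stalled-iterate : (S : Colouring n) → (∀ u → ¬ CanForce S u) → ∀ s c → c ≗ S → iterate k D s c ≗ S
    stalled-iterate S stuck zero    c c≗S = c≗S
    stalled-iterate S stuck (suc s) c c≗S = stalled-iterate S stuck s (step k D c) (stalled-step S stuck c c≗S)

  forcingSet⇒forcer : ∀ {S} → IsForcingSet k D S → ∃ (CanForce S)
  forcingSet⇒forcer {S} (nonempty , s , coloured) with any? (λ u → T? (S u) ×-dec (uncolOut D S u ≤? k))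
  ... | yes forcer = forcer
  ... | no ∄forcer = ⊥-elim (∄forcer (u₀ , Su₀ , u₀-few))
    where
    u₀ : Fin n
    u₀ = proj₁ (anyF⇒∃ {p = S} nonempty)
    Su₀ : T (S u₀)
    Su₀ = proj₂ (anyF⇒∃ {p = S} nonempty)
    everywhere : ∀ v → T (S v)
    everywhere v = subst T (stalled-iterate S (λ u → ∄forcer ∘ (u ,_)) s S (λ _ → refl) v) (coloured v)
    u₀-few : uncolOut D S u₀ ≤ k
    u₀-few = subst (_≤ k) (≡.sym (count-none λ w h →
               subst T (to T-not-≡ (proj₂ (to (T-∧ {arc D u₀ w}) h))) (everywhere w))) z≤n

  forcer-bound : ∀ {S u} → CanForce S u → outdegree D u ∸ k + 1 ≤ count S
  forcer-bound {S} {u} (Su , few) = begin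
    outdegree D u ∸ k + 1   ≤⟨ +-monoˡ-≤ 1 (m≤n+o⇒m∸n≤o (outdegree D u) k out≤) ⟩
    count colouredOut + 1   ≡⟨ +-comm _ 1 ⟩
    suc (count colouredOut) ≤⟨ count-strict u (λ w → proj₂ ∘ to (T-∧ {arc D u w})) Su ¬loop ⟩
    count S                 ∎
    where
    open ≤-Reasoning
    colouredOut : Fin n → Bool
    colouredOut w = arc D u w ∧ S w
    split : ∀ a b → 𝟙 a ≡ 𝟙 (a ∧ b) + 𝟙 (a ∧ not b)
    split true  true  = refl
    split true  false = refl
    split false _     = refl
    out≤ : outdegree D u ≤ k + count colouredOut
    out≤ = begin
      outdegree D u                          ≡⟨ count-split (λ w → split (arc D u w) (S w)) ⟩
      count colouredOut + uncolOut D S u     ≤⟨ +-monoʳ-≤ (count colouredOut) few ⟩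
      count colouredOut + k                  ≡⟨ +-comm _ k ⟩
      k + count colouredOut                  ∎
    ¬loop : ¬ T (colouredOut u)
    ¬loop h = let uu = proj₁ (to (T-∧ {arc D u u}) h) in antisym D u u uu uu

  forcingSet-size : ∀ {t S} → (∀ v → t ≤ outdegree D v) → IsForcingSet k D S → t ∸ k + 1 ≤ count S
  forcingSet-size t≤out forcing with forcingSet⇒forcer forcing
  ... | u , canForce = ≤-trans (+-monoˡ-≤ 1 (∸-monoˡ-≤ k (t≤out u))) (forcer-bound canForce)

forcingSet-nonempty : ∀ {n} {G : Graph n} {k} {D : Orientation G} {S} → IsForcingSet k D S → 1 ≤ count S
forcingSet-nonempty {S = S} (nonempty , _) with anyF⇒∃ {p = S} nonempty
... | u , Su = ≤-trans (s≤s z≤n) (count-strict {q = λ _ → false} u (λ _ ()) Su (λ ()))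

-- The argument works for every k.
proposition3p13 : (m : ℕ) (G : Graph (suc m)) (δ : ℕ) → IsMinDegree G δ →
    (k : ℕ) → 1 ≤ k → MOFAtLeast G k (((δ / 2) ∸ k + 1) ⊔ 1)
proposition3p13 m G δ (_ , δ≤deg) k _
  with balancedOrientation (δ / 2) (λ v → ≤-trans (n/2+n/2≤n δ) (δ≤deg v))
... | D , t≤out = D , λ S forcing → ⊔-lub (forcingSet-size k D t≤out forcing) (forcingSet-nonempty forcing)
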